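{- Let $NC$ be an initial neuronal circuit satisfying $\mathit{NegativeLoop}(NC)$, with neurons $N_0,N_1$ (identifiers $0,1$). Assume $w_{N_0}(2)\ge\tau_{N_0}$, $w_{N_1}(0)\ge\tau_{N_1}$, $w_{N_0}(1)+w_{N_0}(2)\ge 0$ and $(1+lk_{N_0})\cdot(w_{N_0}(1)+w_{N_0}(2))<\tau_{N_0}$. Let $\mathit{inp}$ be an external input sequence (list of booleans) all of whose entries are $1$. Then $$output_{NC}(N_0,\mathit{inp})=\mathit{repeat\_pattern}([0;1;1;0],|\mathit{inp}|+1)\quad\text{and}\quad output_{NC}(N_1,\mathit{inp})=\mathit{repeat\_pattern}([0;0;1;1],|\mathit{inp}|+1).$$
   Context: Booleans are identified with $0$ (false) and $1$ (true). A neuron $N$ consists of an identifier $id_N\in\mathbb{N}$, a weight function $w_N:\mathbb{N}\to\mathbb{Q}$ with $-1\le w_N(x)\le 1$ for all $x$ and $w_N(id_N)=0$, a leak factor $lk_N\in\mathbb{Q}$ with $0\le lk_N\le 1$, a threshold $\tau_N\in\mathbb{Q}$ with $\tau_N>0$, an output list $Output(N)$ of booleans (most recent first) and a current potential $CurPot(N)\in\mathbb{Q}$, subject to: $(\tau_N\le CurPot(N))$ equals the head of $Output(N)$ (the head of an empty list being $0$). An input function is a map $i:\mathbb{N}\to\{0,1\}$; $potential(w,i,len)=\sum_{0\le k<len,\ i(k)=1} w(k)$. The one-step update of $N$ with input function $i$ in an environment of $len$ neurons keeps $id,w,lk,\tau$, sets the new potential $p=potential(w_N,i,len)$ if $\tau_N\le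 CurPot(N)$ and $p=potential(w_N,i,len)+lk_N\cdot CurPot(N)$ otherwise, and sets the new output list to $(\tau_N\le p)::Output(N)$. A neuron is initial if its output list is $[0]$ and its current potential is $0$. A neuronal circuit $NC$ consists of a time $t_{NC}$, a list $ln_{NC}$ of neurons with pairwise distinct identifiers all $<|ln_{NC}|$ and all output lists of length $t_{NC}+1$, and a number $si_{NC}$ of external sources, with identifiers $|ln_{NC}|,\dots,L-1$, $L=|ln_{NC}|+si_{NC}$. One step of $NC$ on an external input function $e$ replaces each neuron $N$ by its one-step update in an environment of $L$ neurons with input function $x\mapsto$ (head of the output list, before the step, of the circuit neuron with identifier $x$ if $x<|ln_{NC}|$; $e(x)$ otherwise), and increments the time. A list of external inputs (most recent first) is processed from its last element to its first. $output_{NC}(N,\mathit{inp})$ is the output list of the neuron with identifier $id_N$ after processing $\mathit{inp}$. $NC$ is initial if all its neurons are initial. When $si_{NC}=1$, an external input sequence is a list of booleans, each giving the value supplied by the unique external source at that step. $\mathit{NegativeLoop}(NC)$ means: $si_{NC}=1$, $|ln_{NC}|=2$, the neuron with identifier $0$ has $w(1)<0$ and $w(2)>0$, and the neuron with identifier $1$ has $w(0)>0$ and $w(2)=0$ (the external source has identifier $2$). For a nonempty list $l=[l_0;\dots;l_{r-1}]$, $\mathit{repeat\_pattern}(l,k)=[x_{k-1};\dots;x_1;x_0]$ with $x_j=l_{j\bmod r}$ (e.g. $\mathit{repeat\_pattern}([1;0],3)=[1;0;1]$). -}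

module Defs where

open import Data.Bool using (Bool; true; false; if_then_else_)
open import Data.Nat as ℕ using (ℕ; zero; suc; _%_)
open import Data.List using (List; []; _∷_; length; map; foldr)
open import Data.List.Relation.Unary.All using (All)
open import Data.List.Relation.Unary.Unique.Propositional using (Unique)
open import Data.Maybe using (Maybe; just; nothing)
open import Data.Product using (_×_; Σ)
open import Data.Rational using (ℚ; 0ℚ; 1ℚ; _≤_; _<_; _≤ᵇ_; _+_; _*_; -_)
open import Relation.Binary.PropositionalEquality using (_≡_)

record Neuron : Set where
  constructor mkNeuron
  field
    id     : ℕ
    w      : ℕ → ℚ
    lk     : ℚ
    τ      : ℚ
    Output : List Bool   -- most recent first
    CurPot : ℚ

open Neuron public

headB : List Bool → Bool
headB []      = false
headB (b ∷ _) = b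

record IsNeuron (N : Neuron) : Set where
  field
    w-lower : ∀ x → - 1ℚ ≤ w N x
    w-upper : ∀ x → w N x ≤ 1ℚ
    w-self  : w N (id N) ≡ 0ℚ
    lk-lower : 0ℚ ≤ lk N
    lk-upper : lk N ≤ 1ℚ
    τ-pos   : 0ℚ < τ N
    pot-out : (τ N ≤ᵇ CurPot N) ≡ headB (Output N)

potential : (ℕ → ℚ) → (ℕ → Bool) → ℕ → ℚ
potential w i zero    = 0ℚ
potential w i (suc k) = potential w i k + (if i k then w k else 0ℚ)

updateNeuron : (ℕ → Bool) → ℕ → Neuron → Neuron
updateNeuron i len N = mkNeuron (id N) (w N) (lk N) (τ N) ((τ N ≤ᵇ p) ∷ Output N) p
  where
  p : ℚ
  p = if τ N ≤ᵇ CurPot N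
        then potential (w N) i len
        else potential (w N) i len + lk N * CurPot N

IsInitialNeuron : Neuron → Set
IsInitialNeuron N = (Output N ≡ false ∷ []) × (CurPot N ≡ 0ℚ)

record Circuit : Set where
  constructor mkCircuit
  field
    time : ℕ
    ln   : List Neuron
    si   : ℕ

open Circuit public

record IsCircuit (NC : Circuit) : Set where
  field
    neurons-wf : All IsNeuron (ln NC)
    ids-unique : Unique (map id (ln NC))
    ids-bound  : All (λ N → id N ℕ.< length (ln NC)) (ln NC)
    out-length : All (λ N → length (Output N) ≡ suc (time NC)) (ln NC)

IsInitialCircuit : Circuit → Set
IsInitialCircuit NC = All IsInitialNeuron (ln NC)

findNeuron : List Neuron → ℕ → Maybe Neuron
findNeuron []       n = nothing
findNeuron (N ∷ ns) n = if id N ℕ.≡ᵇ n then just N else findNeuron ns n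

stepCircuit : (ℕ → Bool) → Circuit → Circuit
stepCircuit e NC = mkCircuit (suc (time NC)) (map (updateNeuron inp L) (ln NC)) (si NC)
  where
  L : ℕ
  L = length (ln NC) ℕ.+ si NC
  cur : Maybe Neuron → Bool
  cur (just N) = headB (Output N)
  cur nothing  = false
  inp : ℕ → Bool
  inp x = if x ℕ.<ᵇ length (ln NC) then cur (findNeuron (ln NC) x) else e x

-- process a list of external input functions (most recent first), from last to first
processInputs : List (ℕ → Bool) → Circuit → Circuit
processInputs []       NC = NC
processInputs (e ∷ es) NC = stepCircuit e (processInputs es NC)

-- with a single external source: a list of booleans, each the value of that source
processSeq : List Bool → Circuit → Circuit
processSeq bs = processInputs (map (λ b _ → b) bs)

outputNC : Circuit → ℕ → List Bool → Maybe (List Bool)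
outputNC NC n bs with findNeuron (ln (processSeq bs NC)) n
... | just N  = just (Output N)
... | nothing = nothing

NegativeLoop : Circuit → Set
NegativeLoop NC =
  (si NC ≡ 1) × (length (ln NC) ≡ 2) ×
  Σ Neuron (λ N0 → Σ Neuron (λ N1 →
    (findNeuron (ln NC) 0 ≡ just N0) × (findNeuron (ln NC) 1 ≡ just N1) ×
    (w N0 1 < 0ℚ) × (0ℚ < w N0 2) × (0ℚ < w N1 0) × (w N1 2 ≡ 0ℚ)))

-- nth element with default (only used with in-range indices)
nth : List Bool → ℕ → Bool
nth []       _       = false
nth (x ∷ _)  zero    = x
nth (_ ∷ xs) (suc j) = nth xs j

repeatPattern : List Bool → ℕ → List Bool
repeatPattern []         k = []
repeatPattern l@(x ∷ xs) k = go k
  where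
  go : ℕ → List Bool
  go zero    = []
  go (suc j) = nth l (j % length l) ∷ go j

{-# OPTIONS --safe #-}
-- Started at rest and driven by the source, the loop cycles with period 4 through the phases
-- in which no neuron, N₀, both, N₁ fire. A fired neuron forgets its potential, so N₀ fires on
-- the source alone (w₀(2) ≥ τ₀) twice in a row; then N₁, which copies N₀ one step late,
-- inhibits it. With inhibition the input to N₀ is σ = w₀(1) + w₀(2) ≥ 0, and one step of leak
-- adds at most lk₀ σ, so (1 + lk₀) σ < τ₀ keeps N₀ silent for the next two steps.
module Submission where

open import Defs
open import Data.Bool using (Bool; true; false; if_then_else_)
open import Data.Bool.Properties using (T-≡; ¬-not)
open import Data.Empty using (⊥-elim)
open import Data.Nat as ℕ using (ℕ; suc; _%_)
open import Data.Nat.Divisibility using (∣-refl)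
open import Data.Nat.DivMod using (%-remove-+ˡ)
open import Data.Nat.Properties using (≡ᵇ⇒≡; 0≢1+n)
open import Data.List using (List; []; _∷_; length)
open import Data.List.Membership.Propositional using (_∈_)
open import Data.List.Relation.Unary.All as All using (All; []; _∷_)
open import Data.List.Relation.Unary.Any using (here; there)
open import Data.Maybe using (just)
open import Data.Maybe.Properties using (just-injective)
open import Data.Product using (_×_; _,_)
open import Data.Rational using (ℚ; 0ℚ; 1ℚ; _≤_; _<_; _+_; _*_; _≤ᵇ_; nonNegative)
open import Data.Rational.Properties
open import Data.Rational.Solver using (module +-*-Solver)
open import Function using (Equivalence)
open import Relation.Binary.PropositionalEquality

≤ᵇ-true : ∀ {p q} → p ≤ q → (p ≤ᵇ q) ≡ true
≤ᵇ-true p≤q = Equivalence.to T-≡ (≤⇒≤ᵇ p≤q)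

≤ᵇ-false : ∀ {p q} → q < p → (p ≤ᵇ q) ≡ false
≤ᵇ-false q<p = ¬-not λ p≤ᵇq → <-irrefl refl (<-≤-trans q<p (≤ᵇ⇒≤ (Equivalence.from T-≡ p≤ᵇq)))

p≤p+q : ∀ {p q} → 0ℚ ≤ q → p ≤ p + q
p≤p+q {p} 0≤q = ≤-trans (≤-reflexive (sym (+-identityʳ p))) (+-monoʳ-≤ p 0≤q)

0≤p*q : ∀ {p q} → 0ℚ ≤ p → 0ℚ ≤ q → 0ℚ ≤ p * q
0≤p*q {p} 0≤p 0≤q = ≤-trans (≤-reflexive (sym (*-zeroʳ p))) (*-monoˡ-≤-nonNeg p {{nonNegative 0≤p}} 0≤q)

p+r*q≤[1+r]*p : ∀ {p q r} → 0ℚ ≤ r → q ≤ p → p + r * q ≤ (1ℚ + r) * p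
p+r*q≤[1+r]*p {p} {q} {r} 0≤r q≤p = begin
  p + r * q         ≤⟨ +-monoʳ-≤ p (*-monoˡ-≤-nonNeg r {{nonNegative 0≤r}} q≤p) ⟩
  p + r * p         ≡⟨ solve 2 (λ r p → p :+ r :* p := (con 1ℚ :+ r) :* p) refl r p ⟩
  (1ℚ + r) * p      ∎
  where
  open ≤-Reasoning
  open +-*-Solver

data Phase : Set where
  silent only₀ both only₁ : Phase

next : Phase → Phase
next silent = only₀
next only₀  = both
next both   = only₁
next only₁  = silent

phase : ℕ → Phase
phase 0 = silent
phase 1 = only₀
phase 2 = both
phase 3 = only₁
phase (suc (suc (suc (suc k)))) = phase k

phase-suc : ∀ k → phase (suc k) ≡ next (phase k)
phase-suc 0 = refl
phase-suc 1 = refl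
phase-suc 2 = refl
phase-suc 3 = refl
phase-suc (suc (suc (suc (suc k)))) = phase-suc k

index : Phase → ℕ
index silent = 0
index only₀  = 1
index both   = 2
index only₁  = 3

index-phase : ∀ k → index (phase k) ≡ k % 4
index-phase 0 = refl
index-phase 1 = refl
index-phase 2 = refl
index-phase 3 = refl
index-phase (suc (suc (suc (suc k)))) = trans (index-phase k) (sym (%-remove-+ˡ k (∣-refl {4})))

pattern₀ pattern₁ : List Bool
pattern₀ = false ∷ true ∷ true ∷ false ∷ []
pattern₁ = false ∷ false ∷ true ∷ true ∷ []

spike₀ spike₁ : Phase → Bool
spike₀ ph = nth pattern₀ (index ph)
spike₁ ph = nth pattern₁ (index ph)

headB-repeatPattern : ∀ a b c d k → let l = a ∷ b ∷ c ∷ d ∷ [] in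
  headB (repeatPattern l (suc k)) ≡ nth l (index (phase k))
headB-repeatPattern a b c d k = cong (nth (a ∷ b ∷ c ∷ d ∷ [])) (sym (index-phase k))

findNeuron-∈ : ∀ ns {n N} → findNeuron ns n ≡ just N → N ∈ ns
findNeuron-∈ (M ∷ ns) {n} eq with id M ℕ.≡ᵇ n
... | true  = here (sym (just-injective eq))
... | false = there (findNeuron-∈ ns eq)

findNeuron-id : ∀ ns {n N} → findNeuron ns n ≡ just N → id N ≡ n
findNeuron-id (M ∷ ns) {n} eq with id M ℕ.≡ᵇ n in idM≡ᵇn
... | true  = trans (cong id (sym (just-injective eq))) (≡ᵇ⇒≡ (id M) n (Equivalence.from T-≡ idM≡ᵇn))
... | false = findNeuron-id ns eq

outputNC-findNeuron : ∀ NC n bs {N} → findNeuron (ln (processSeq bs NC)) n ≡ just N →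
  outputNC NC n bs ≡ just (Output N)
outputNC-findNeuron NC n bs eq with findNeuron (ln (processSeq bs NC)) n
outputNC-findNeuron NC n bs refl | just _ = refl

findNeuron-IsNeuron : ∀ {NC n N} → IsCircuit NC → findNeuron (ln NC) n ≡ just N → IsNeuron N
findNeuron-IsNeuron {NC} isC f = All.lookup (IsCircuit.neurons-wf isC) (findNeuron-∈ (ln NC) f)

findNeuron-w-self : ∀ {NC n N} → IsCircuit NC → findNeuron (ln NC) n ≡ just N → w N n ≡ 0ℚ
findNeuron-w-self {NC} {N = N} isC f =
  subst (λ k → w N k ≡ 0ℚ) (findNeuron-id (ln NC) f) (IsNeuron.w-self (findNeuron-IsNeuron isC f))

initialNeuron-η : ∀ {N n} → IsInitialNeuron N → id N ≡ n → N ≡ mkNeuron n (w N) (lk N) (τ N) (false ∷ []) 0ℚ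
initialNeuron-η (out , pot) refl = cong₂ (mkNeuron _ _ _ _) out pot

findNeuron-initial : ∀ {ns n N} → All IsInitialNeuron ns → findNeuron ns n ≡ just N →
  N ≡ mkNeuron n (w N) (lk N) (τ N) (false ∷ []) 0ℚ
findNeuron-initial {ns} init f = initialNeuron-η (All.lookup init (findNeuron-∈ ns f)) (findNeuron-id ns f)

updateNeuron-fired : ∀ i len N → τ N ≤ CurPot N → CurPot (updateNeuron i len N) ≡ potential (w N) i len
updateNeuron-fired i len N τ≤p rewrite ≤ᵇ-true τ≤p = refl

updateNeuron-silent : ∀ i len N → CurPot N < τ N →
  CurPot (updateNeuron i len N) ≡ potential (w N) i len + lk N * CurPot N
updateNeuron-silent i len N p<τ rewrite ≤ᵇ-false p<τ = refl

loopInput : Bool → Bool → ℕ → Bool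
loopInput a b 0 = a
loopInput a b 1 = b
loopInput a b _ = true

potential-loopInput₀ : ∀ {w} → w 0 ≡ 0ℚ → ∀ a b →
  potential w (loopInput a b) 3 ≡ (if b then w 1 + w 2 else w 2)
potential-loopInput₀ {w} w0≡0 a b rewrite w0≡0 with a | b
... | true  | true  = cong (_+ w 2) (+-identityˡ (w 1))
... | true  | false = +-identityˡ (w 2)
... | false | true  = cong (_+ w 2) (+-identityˡ (w 1))
... | false | false = +-identityˡ (w 2)

potential-loopInput₁ : ∀ {w} → w 1 ≡ 0ℚ → w 2 ≡ 0ℚ → ∀ a b →
  potential w (loopInput a b) 3 ≡ (if a then w 0 else 0ℚ)
potential-loopInput₁ {w} w1≡0 w2≡0 a b rewrite w1≡0 | w2≡0 with a | b
... | true  | true  = trans (+-identityʳ _) (trans (+-identityʳ _) (+-identityˡ (w 0)))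
... | true  | false = trans (+-identityʳ _) (trans (+-identityʳ _) (+-identityˡ (w 0)))
... | false | true  = refl
... | false | false = refl

module TwoNeuronCircuit (w₀ w₁ : ℕ → ℚ) (lk₀ lk₁ τ₀ τ₁ : ℚ) where

  record State : Set where
    field
      out₀ : List Bool
      pot₀ : ℚ
      out₁ : List Bool
      pot₁ : ℚ

  open State public

  neuron₀ neuron₁ : State → Neuron
  neuron₀ s = mkNeuron 0 w₀ lk₀ τ₀ (out₀ s) (pot₀ s)
  neuron₁ s = mkNeuron 1 w₁ lk₁ τ₁ (out₁ s) (pot₁ s)

  initialState : State
  initialState = record { out₀ = false ∷ [] ; pot₀ = 0ℚ ; out₁ = false ∷ [] ; pot₁ = 0ℚ }

  step : State → State
  step s = record { out₀ = Output N₀ ; pot₀ = CurPot N₀ ; out₁ = Output N₁ ; pot₁ = CurPot N₁ }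
    where
    i : ℕ → Bool
    i = loopInput (headB (out₀ s)) (headB (out₁ s))
    N₀ N₁ : Neuron
    N₀ = updateNeuron i 3 (neuron₀ s)
    N₁ = updateNeuron i 3 (neuron₁ s)

  data Realises (s : State) : Circuit → Set where
    ordered : ∀ t → Realises s (mkCircuit t (neuron₀ s ∷ neuron₁ s ∷ []) 1)
    swapped : ∀ t → Realises s (mkCircuit t (neuron₁ s ∷ neuron₀ s ∷ []) 1)

  -- Holds by computation: in an environment of 3 neurons the input that stepCircuit builds
  -- coincides with loopInput on the two outputs.
  realises-step : ∀ {s C} → Realises s C → Realises (step s) (stepCircuit (λ _ → true) C)
  realises-step (ordered t) = ordered (suc t)
  realises-step (swapped t) = swapped (suc t)

  iterate : ℕ → State → State
  iterate 0       s = s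
  iterate (suc n) s = step (iterate n s)

  realises-processSeq : ∀ {s C bs} → All (_≡ true) bs → Realises s C →
    Realises (iterate (length bs) s) (processSeq bs C)
  realises-processSeq []             r = r
  realises-processSeq (refl ∷ trues) r = realises-step (realises-processSeq trues r)

  findNeuron₀ : ∀ {s C} → Realises s C → findNeuron (ln C) 0 ≡ just (neuron₀ s)
  findNeuron₀ (ordered t) = refl
  findNeuron₀ (swapped t) = refl

  findNeuron₁ : ∀ {s C} → Realises s C → findNeuron (ln C) 1 ≡ just (neuron₁ s)
  findNeuron₁ (ordered t) = refl
  findNeuron₁ (swapped t) = refl

initialCircuit-realises : ∀ {NC N₀ N₁} → IsInitialCircuit NC → si NC ≡ 1 → length (ln NC) ≡ 2 →
  findNeuron (ln NC) 0 ≡ just N₀ → findNeuron (ln NC) 1 ≡ just N₁ →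
  let open TwoNeuronCircuit (w N₀) (w N₁) (lk N₀) (lk N₁) (τ N₀) (τ N₁) in Realises initialState NC
initialCircuit-realises {mkCircuit _ [] _}                _ _ ()
initialCircuit-realises {mkCircuit _ (_ ∷ []) _}          _ _ ()
initialCircuit-realises {mkCircuit _ (_ ∷ _ ∷ _ ∷ _) _}   _ _ ()
initialCircuit-realises {mkCircuit t (A ∷ B ∷ []) _} init refl refl f₀ f₁
  with findNeuron-∈ (A ∷ B ∷ []) f₀ | findNeuron-∈ (A ∷ B ∷ []) f₁
     | findNeuron-initial init f₀   | findNeuron-initial init f₁
... | here refl         | here refl         | e₀   | e₁   = ⊥-elim (0≢1+n (cong id (trans (sym e₀) e₁)))
... | there (here refl) | there (here refl) | e₀   | e₁   = ⊥-elim (0≢1+n (cong id (trans (sym e₀) e₁)))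
... | here refl         | there (here refl) | refl | refl = TwoNeuronCircuit.ordered t
... | there (here refl) | here refl         | refl | refl = TwoNeuronCircuit.swapped t

module NegativeLoopDynamics
  (w₀ w₁ : ℕ → ℚ) (lk₀ lk₁ τ₀ τ₁ : ℚ)
  (w₀0≡0 : w₀ 0 ≡ 0ℚ) (w₁1≡0 : w₁ 1 ≡ 0ℚ) (w₁2≡0 : w₁ 2 ≡ 0ℚ)
  (0≤lk₀ : 0ℚ ≤ lk₀) (0<τ₀ : 0ℚ < τ₀) (0<τ₁ : 0ℚ < τ₁)
  (τ₀≤w₀2 : τ₀ ≤ w₀ 2) (τ₁≤w₁0 : τ₁ ≤ w₁ 0)
  (0≤σ : 0ℚ ≤ w₀ 1 + w₀ 2) ([1+lk₀]σ<τ₀ : (1ℚ + lk₀) * (w₀ 1 + w₀ 2) < τ₀)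
  where

  open TwoNeuronCircuit w₀ w₁ lk₀ lk₁ τ₀ τ₁

  σ : ℚ
  σ = w₀ 1 + w₀ 2

  σ<τ₀ : σ < τ₀
  σ<τ₀ = ≤-<-trans (≤-trans (p≤p+q (0≤p*q 0≤lk₀ 0≤σ)) (p+r*q≤[1+r]*p 0≤lk₀ ≤-refl)) [1+lk₀]σ<τ₀

  Potential₀ : Phase → ℚ → Set
  Potential₀ silent p = 0ℚ ≤ p × p < τ₀
  Potential₀ only₀  p = τ₀ ≤ p
  Potential₀ both   p = τ₀ ≤ p
  Potential₀ only₁  p = 0ℚ ≤ p × p ≤ σ

  Potential₁ : Phase → ℚ → Set
  Potential₁ silent p = p ≡ 0ℚ
  Potential₁ only₀  p = p ≡ 0ℚ
  Potential₁ both   p = τ₁ ≤ p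
  Potential₁ only₁  p = τ₁ ≤ p

  spike₀-potential : ∀ ph {p} → Potential₀ ph p → (τ₀ ≤ᵇ p) ≡ spike₀ ph
  spike₀-potential silent (_ , p<τ₀) = ≤ᵇ-false p<τ₀
  spike₀-potential only₀  τ₀≤p       = ≤ᵇ-true τ₀≤p
  spike₀-potential both   τ₀≤p       = ≤ᵇ-true τ₀≤p
  spike₀-potential only₁  (_ , p≤σ)  = ≤ᵇ-false (≤-<-trans p≤σ σ<τ₀)

  spike₁-potential : ∀ ph {p} → Potential₁ ph p → (τ₁ ≤ᵇ p) ≡ spike₁ ph
  spike₁-potential silent refl = ≤ᵇ-false 0<τ₁
  spike₁-potential only₀  refl = ≤ᵇ-false 0<τ₁
  spike₁-potential both   τ₁≤p = ≤ᵇ-true τ₁≤p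
  spike₁-potential only₁  τ₁≤p = ≤ᵇ-true τ₁≤p

  phaseInput : Phase → ℕ → Bool
  phaseInput ph = loopInput (spike₀ ph) (spike₁ ph)

  -- The new potential does not depend on the output history, hence the empty one.
  nextPotential₀ nextPotential₁ : Phase → ℚ → ℚ
  nextPotential₀ ph p = CurPot (updateNeuron (phaseInput ph) 3 (mkNeuron 0 w₀ lk₀ τ₀ [] p))
  nextPotential₁ ph p = CurPot (updateNeuron (phaseInput ph) 3 (mkNeuron 1 w₁ lk₁ τ₁ [] p))

  fired₀ : ∀ ph {p} → τ₀ ≤ p → nextPotential₀ ph p ≡ (if spike₁ ph then σ else w₀ 2)
  fired₀ ph {p} τ₀≤p = trans (updateNeuron-fired (phaseInput ph) 3 (mkNeuron 0 w₀ lk₀ τ₀ [] p) τ₀≤p)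
    (potential-loopInput₀ {w₀} w₀0≡0 (spike₀ ph) (spike₁ ph))

  silent₀ : ∀ ph {p} → p < τ₀ → nextPotential₀ ph p ≡ (if spike₁ ph then σ else w₀ 2) + lk₀ * p
  silent₀ ph {p} p<τ₀ = trans (updateNeuron-silent (phaseInput ph) 3 (mkNeuron 0 w₀ lk₀ τ₀ [] p) p<τ₀)
    (cong (_+ lk₀ * p) (potential-loopInput₀ {w₀} w₀0≡0 (spike₀ ph) (spike₁ ph)))

  fired₁ : ∀ ph {p} → τ₁ ≤ p → nextPotential₁ ph p ≡ (if spike₀ ph then w₁ 0 else 0ℚ)
  fired₁ ph {p} τ₁≤p = trans (updateNeuron-fired (phaseInput ph) 3 (mkNeuron 1 w₁ lk₁ τ₁ [] p) τ₁≤p)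
    (potential-loopInput₁ {w₁} w₁1≡0 w₁2≡0 (spike₀ ph) (spike₁ ph))

  silent₁ : ∀ ph {p} → p < τ₁ → nextPotential₁ ph p ≡ (if spike₀ ph then w₁ 0 else 0ℚ) + lk₁ * p
  silent₁ ph {p} p<τ₁ = trans (updateNeuron-silent (phaseInput ph) 3 (mkNeuron 1 w₁ lk₁ τ₁ [] p) p<τ₁)
    (cong (_+ lk₁ * p) (potential-loopInput₁ {w₁} w₁1≡0 w₁2≡0 (spike₀ ph) (spike₁ ph)))

  potential₀-next : ∀ ph {p} → Potential₀ ph p → Potential₀ (next ph) (nextPotential₀ ph p)
  potential₀-next silent (0≤p , p<τ₀) =
    subst (τ₀ ≤_) (sym (silent₀ silent p<τ₀)) (≤-trans τ₀≤w₀2 (p≤p+q (0≤p*q 0≤lk₀ 0≤p)))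
  potential₀-next only₀ τ₀≤p = subst (τ₀ ≤_) (sym (fired₀ only₀ τ₀≤p)) τ₀≤w₀2
  potential₀-next both τ₀≤p = subst (λ q → 0ℚ ≤ q × q ≤ σ) (sym (fired₀ both τ₀≤p)) (0≤σ , ≤-refl)
  potential₀-next only₁ (0≤p , p≤σ) =
    subst (λ q → 0ℚ ≤ q × q < τ₀) (sym (silent₀ only₁ (≤-<-trans p≤σ σ<τ₀)))
      (≤-trans 0≤σ (p≤p+q (0≤p*q 0≤lk₀ 0≤p)) , ≤-<-trans (p+r*q≤[1+r]*p 0≤lk₀ p≤σ) [1+lk₀]σ<τ₀)

  potential₁-next : ∀ ph {p} → Potential₁ ph p → Potential₁ (next ph) (nextPotential₁ ph p)
  potential₁-next silent refl = trans (silent₁ silent 0<τ₁) (trans (+-identityˡ _) (*-zeroʳ lk₁))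
  potential₁-next only₀ refl =
    subst (τ₁ ≤_) (sym (silent₁ only₀ 0<τ₁)) (≤-trans τ₁≤w₁0 (p≤p+q (≤-reflexive (sym (*-zeroʳ lk₁)))))
  potential₁-next both τ₁≤p = subst (τ₁ ≤_) (sym (fired₁ both τ₁≤p)) τ₁≤w₁0
  potential₁-next only₁ τ₁≤p = fired₁ only₁ τ₁≤p

  record Invariant (k : ℕ) (s : State) : Set where
    field
      outputs₀   : out₀ s ≡ repeatPattern pattern₀ (suc k)
      outputs₁   : out₁ s ≡ repeatPattern pattern₁ (suc k)
      potential₀ : Potential₀ (phase k) (pot₀ s)
      potential₁ : Potential₁ (phase k) (pot₁ s)

  open Invariant

  invariant-initial : Invariant 0 initialState
  invariant-initial = record { outputs₀ = refl ; outputs₁ = refl ; potential₀ = ≤-refl , 0<τ₀ ; potential₁ = refl }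

  invariant-step : ∀ {k s} → Invariant k s → Invariant (suc k) (step s)
  invariant-step {k} {s} inv = record
    { outputs₀   = cong₂ _∷_ (trans (spike₀-potential _ next₀) (sym (headB-repeatPattern false true true false (suc k))))
                             (outputs₀ inv)
    ; outputs₁   = cong₂ _∷_ (trans (spike₁-potential _ next₁) (sym (headB-repeatPattern false false true true (suc k))))
                             (outputs₁ inv)
    ; potential₀ = next₀
    ; potential₁ = next₁
    }
    where
    input≡ : loopInput (headB (out₀ s)) (headB (out₁ s)) ≡ phaseInput (phase k)
    input≡ = cong₂ loopInput
      (trans (cong headB (outputs₀ inv)) (headB-repeatPattern false true true false k))
      (trans (cong headB (outputs₁ inv)) (headB-repeatPattern false false true true k))
    next₀ : Potential₀ (phase (suc k)) (pot₀ (step s))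
    next₀ = subst₂ Potential₀ (sym (phase-suc k))
      (cong (λ i → CurPot (updateNeuron i 3 (neuron₀ s))) (sym input≡)) (potential₀-next (phase k) (potential₀ inv))
    next₁ : Potential₁ (phase (suc k)) (pot₁ (step s))
    next₁ = subst₂ Potential₁ (sym (phase-suc k))
      (cong (λ i → CurPot (updateNeuron i 3 (neuron₁ s))) (sym input≡)) (potential₁-next (phase k) (potential₁ inv))

  invariant-iterate : ∀ n → Invariant n (iterate n initialState)
  invariant-iterate 0       = invariant-initial
  invariant-iterate (suc n) = invariant-step (invariant-iterate n)

  outputNC-repeatPattern : ∀ NC inp → All (_≡ true) inp → Realises initialState NC →
    (outputNC NC 0 inp ≡ just (repeatPattern pattern₀ (suc (length inp))))
    × (outputNC NC 1 inp ≡ just (repeatPattern pattern₁ (suc (length inp))))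
  outputNC-repeatPattern NC inp trues r =
    trans (outputNC-findNeuron NC 0 inp (findNeuron₀ r′)) (cong just (outputs₀ inv)) ,
    trans (outputNC-findNeuron NC 1 inp (findNeuron₁ r′)) (cong just (outputs₁ inv))
    where
    r′ : Realises (iterate (length inp) initialState) (processSeq inp NC)
    r′ = realises-processSeq trues r
    inv : Invariant (length inp) (iterate (length inp) initialState)
    inv = invariant-iterate (length inp)

proposition6p7 : (NC : Circuit) → IsCircuit NC → IsInitialCircuit NC → NegativeLoop NC →
    (N0 N1 : Neuron) → findNeuron (ln NC) 0 ≡ just N0 → findNeuron (ln NC) 1 ≡ just N1 →
    τ N0 ≤ w N0 2 → τ N1 ≤ w N1 0 → 0ℚ ≤ w N0 1 + w N0 2 →
    (1ℚ + lk N0) * (w N0 1 + w N0 2) < τ N0 →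
    (inp : List Bool) → All (λ b → b ≡ true) inp →
    (outputNC NC 0 inp ≡ just (repeatPattern (false ∷ true ∷ true ∷ false ∷ []) (suc (length inp))))
    × (outputNC NC 1 inp ≡ just (repeatPattern (false ∷ false ∷ true ∷ true ∷ []) (suc (length inp))))
proposition6p7 NC isC init (si≡1 , len≡2 , _ , M₁ , _ , f₁′ , _ , _ , _ , wM₁2≡0)
               N₀ N₁ f₀ f₁ τ₀≤w₀2 τ₁≤w₁0 0≤σ [1+lk₀]σ<τ₀ inp trues =
  outputNC-repeatPattern NC inp trues (initialCircuit-realises init si≡1 len≡2 f₀ f₁)
  where
  w₁2≡0 : w N₁ 2 ≡ 0ℚ
  w₁2≡0 = subst (λ M → w M 2 ≡ 0ℚ) (just-injective (trans (sym f₁′) f₁)) wM₁2≡0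
  open IsNeuron
  open NegativeLoopDynamics (w N₀) (w N₁) (lk N₀) (lk N₁) (τ N₀) (τ N₁)
    (findNeuron-w-self isC f₀) (findNeuron-w-self isC f₁) w₁2≡0
    (lk-lower (findNeuron-IsNeuron isC f₀))
    (τ-pos (findNeuron-IsNeuron isC f₀)) (τ-pos (findNeuron-IsNeuron isC f₁))
    τ₀≤w₀2 τ₁≤w₁0 0≤σ [1+lk₀]σ<τ₀
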